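{- Let $u$ be an indeterminate. Define elements $\alpha_i,\beta_i$ of $\mathbb{Q}(u)$ for $i\ge1$ by the following rules, valid for all $k\ge0$: - $\alpha_{2k+1}=-u$ and $\alpha_{2k+2}=u$; - $\beta_1=1$ and $\beta_2=u^2-u$; - $\beta_{2k+3}=-\beta_{k+2}/\beta_{2k+2}$; - $\beta_{2k+4}=\alpha_{k+2}+u^2-\beta_{2k+3}$. Then for all $m\ge2$, $$\deg\beta_m=2\bigl(1-\nu_2(m-1)\bigr),$$ where $\deg$ of a nonzero rational function $e/d\in\mathbb{Q}(u)$ means $\deg e-\deg d$, and $\nu_2$ is the $2$-adic valuation of an integer.
   Context: These $\alpha_i,\beta_i$ are the coefficients of the continued fraction $g_u(t)=\mathop{K}_{i\ge1}\frac{\beta_i}{t+\alpha_i}$ of $g_u(t)=t^{ -1}\prod_{n\ge0}(1+u\,t^{ -2^n})$. -}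

module Defs where

open import Data.Bool using (Bool; true; false; if_then_else_; not)
open import Data.Nat using (ℕ; zero; suc)
open import Data.Product using (_×_; _,_; proj₁; proj₂)
open import Data.List using (List; []; _∷_; map)
open import Data.Integer as ℤ using (ℤ; +_)
open import Data.Rational as Q using (ℚ; 0ℚ; 1ℚ)
open import Data.Rational.Properties using (_≟_)
open import Relation.Nullary.Decidable using (⌊_⌋)
open import Relation.Binary.PropositionalEquality using (_≡_)

-- Polynomials in u over ℚ: coefficient lists, lowest degree first.
-- Trailing zero coefficients are allowed (no normal form is imposed).

Poly : Set
Poly = List ℚ

_+P_ : Poly → Poly → Poly
[]      +P q       = q
(a ∷ p) +P []      = a ∷ p
(a ∷ p) +P (b ∷ q) = (a Q.+ b) ∷ (p +P q)

-P_ : Poly → Poly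
-P p = map Q.-_ p

_*P_ : Poly → Poly → Poly
[]      *P q = []
(a ∷ p) *P q = map (a Q.*_) q +P (0ℚ ∷ (p *P q))

isZeroP : Poly → Bool
isZeroP []      = true
isZeroP (a ∷ p) = ⌊ a ≟ 0ℚ ⌋ Data.Bool.∧ isZeroP p
  where import Data.Bool

NonZeroP : Poly → Set
NonZeroP p = isZeroP p ≡ false

-- degree of a polynomial (meaningful for nonzero polynomials):
-- index of the highest nonzero coefficient
degP : Poly → ℕ
degP []      = 0
degP (a ∷ p) = if isZeroP p then 0 else suc (degP p)

-- Elements of ℚ(u) represented as fractions num / den of polynomials
-- (a fraction with den ≠ 0 represents an element of ℚ(u)).

record RF : Set where
  constructor _//_
  field
    num : Poly
    den : Poly
open RF public

_+F_ : RF → RF → RF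
(a // b) +F (c // d) = ((a *P d) +P (c *P b)) // (b *P d)

-F_ : RF → RF
-F (a // b) = (-P a) // b

_-F_ : RF → RF → RF
x -F y = x +F (-F y)

_/F_ : RF → RF → RF
(a // b) /F (c // d) = (a *P d) // (b *P c)

constF : ℚ → RF
constF q = (q ∷ []) // (1ℚ ∷ [])

uF : RF
uF = (0ℚ ∷ 1ℚ ∷ []) // (1ℚ ∷ [])

u²F : RF
u²F = (0ℚ ∷ 0ℚ ∷ 1ℚ ∷ []) // (1ℚ ∷ [])

NonZeroF : RF → Set
NonZeroF x = NonZeroP (num x) × NonZeroP (den x)

degF : RF → ℤ
degF x = (+ degP (num x)) ℤ.- (+ degP (den x))

-- split n = (k , b) with n = 2k + (if b then 1 else 0)
split : ℕ → ℕ × Bool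
split zero = (0 , false)
split (suc zero) = (0 , true)
split (suc (suc n)) with split n
... | (k , b) = (suc k , b)

α : ℕ → RF
α i = if proj₂ (split i) then -F uF else uF

-- βF fuel i computes β_i, provided fuel > i (every recursive call is at a
-- strictly smaller index, so fuel i+1 suffices).
βF : ℕ → ℕ → RF
βF zero _ = constF 0ℚ
βF (suc f) zero = constF 0ℚ                       -- index 0 unused
βF (suc f) (suc zero) = constF 1ℚ
βF (suc f) (suc (suc zero)) = u²F -F uF
βF (suc f) (suc (suc (suc n))) with split n
-- n = 2k : index 2k+3,  β_{2k+3} = - β_{k+2} / β_{2k+2}
... | (k , false) = -F (βF f (suc (suc k)) /F βF f (suc (suc (k Data.Nat.+ k))))
  where import Data.Nat
-- n = 2k+1 : index 2k+4,  β_{2k+4} = α_{k+2} + u² - β_{2k+3}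
... | (k , true) = (α (suc (suc k)) +F u²F) -F βF f (suc (suc (suc (k Data.Nat.+ k))))
  where import Data.Nat

β : ℕ → RF
β i = βF (suc i) i

{-# OPTIONS --safe #-}
module Submission where

-- Write d_m = deg β_m. For m = 2k + 3 the recurrence β_m = -β_{k+2}/β_{2k+2} gives
-- d_m = d_{k+2} - d_{2k+2}, and ν₂(m - 1) = 1 + ν₂(k + 1). For m = 2k + 4 the term u²
-- dominates β_m = α_{k+2} + u² - β_{2k+3}, because odd-indexed β have degree
-- 2(1 - ν₂(even)) ≤ 0; hence d_m = 2 = 2(1 - ν₂(odd)). Exact degrees are certified by nonzero leading coefficients of
-- numerator and denominator, which also shows that β_m is a nonzero fraction.

open import Defs
open import Data.Bool using (Bool; true; false; _∧_)
open import Data.Bool.Properties using (∧-zeroʳ)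
open import Data.Nat as ℕ using (ℕ; zero; suc; z≤n; s≤s; _≤_; _∸_; _^_)
import Data.Nat.Properties as ℕ
open import Data.Nat.Divisibility using (_∣_; divides; 1∣_; ∣-trans; m∣m*n; *-monoʳ-∣; *-cancelˡ-∣)
open import Data.Nat.Induction using (<-rec)
import Data.Nat.Tactic.RingSolver as ℕ-Solver
open import Data.Integer as ℤ using (ℤ; +_; _-_; _*_; +<+; -<+)
import Data.Integer.Properties as ℤ
open import Data.Integer.Tactic.RingSolver using (solve-∀)
open import Data.Rational as ℚ using (ℚ; 0ℚ; 1ℚ)
import Data.Rational.Properties as ℚ
open import Data.List using ([]; _∷_; map; drop)
open import Data.List.Properties using (drop-map)
open import Data.List.Relation.Unary.All using (All; []; _∷_; universal)
open import Data.List.Relation.Unary.All.Properties using (drop⁺; map⁺)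
open import Data.Product using (_×_; _,_; proj₂; ∃-syntax)
open import Data.Empty using (⊥-elim)
open import Function using (_∘_)
open import Relation.Nullary using (¬_)
open import Relation.Nullary.Decidable using (isYes≗does; dec-false)
open import Relation.Binary.PropositionalEquality

Vanishes : Poly → Set
Vanishes = All (_≡ 0ℚ)

data HasDegree : Poly → ℕ → Set where
  leading : ∀ {a p} → a ≢ 0ℚ → Vanishes p → HasDegree (a ∷ p) 0
  shift   : ∀ {a p n} → HasDegree p n → HasDegree (a ∷ p) (suc n)

DegreeBelow : Poly → ℕ → Set
DegreeBelow p n = Vanishes (drop n p)

vanishes⇒isZeroP : ∀ {p} → Vanishes p → isZeroP p ≡ true
vanishes⇒isZeroP []         = refl
vanishes⇒isZeroP (refl ∷ z) = vanishes⇒isZeroP z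

hasDegree⇒nonZeroP : ∀ {p n} → HasDegree p n → NonZeroP p
hasDegree⇒nonZeroP (leading {a} a≢0 _) =
  cong (_∧ _) (trans (isYes≗does (a ℚ.≟ 0ℚ)) (dec-false (a ℚ.≟ 0ℚ) a≢0))
hasDegree⇒nonZeroP (shift {a} d) =
  trans (cong (_ ∧_) (hasDegree⇒nonZeroP d)) (∧-zeroʳ _)

hasDegree⇒degP : ∀ {p n} → HasDegree p n → degP p ≡ n
hasDegree⇒degP (leading _ z) rewrite vanishes⇒isZeroP z = refl
hasDegree⇒degP (shift d) rewrite hasDegree⇒nonZeroP d = cong suc (hasDegree⇒degP d)

degreeBelow-mono : ∀ {p m n} → m ≤ n → DegreeBelow p m → DegreeBelow p n
degreeBelow-mono {p}     {n = n} z≤n       b = drop⁺ n b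
degreeBelow-mono {[]}            (s≤s _)   _ = []
degreeBelow-mono {a ∷ p}         (s≤s m≤n) b = degreeBelow-mono {p} m≤n b

hasDegree⇒degreeBelow : ∀ {p n} → HasDegree p n → DegreeBelow p (suc n)
hasDegree⇒degreeBelow (leading _ z) = z
hasDegree⇒degreeBelow (shift d)     = hasDegree⇒degreeBelow d

+P-comm : ∀ p q → p +P q ≡ q +P p
+P-comm []      []      = refl
+P-comm []      (b ∷ q) = refl
+P-comm (a ∷ p) []      = refl
+P-comm (a ∷ p) (b ∷ q) = cong₂ _∷_ (ℚ.+-comm a b) (+P-comm p q)

+P-vanishes : ∀ {p q} → Vanishes p → Vanishes q → Vanishes (p +P q)
+P-vanishes []          zq          = zq
+P-vanishes (z ∷ zp)    []          = z ∷ zp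
+P-vanishes (refl ∷ zp) (refl ∷ zq) = refl ∷ +P-vanishes zp zq

+P-hasDegreeˡ : ∀ {p q n} → HasDegree p n → DegreeBelow q n → HasDegree (p +P q) n
+P-hasDegreeˡ {a ∷ p} {[]}    d                _           = d
+P-hasDegreeˡ {a ∷ p} {b ∷ q} (leading a≢0 zp) (refl ∷ zq) =
  leading (a≢0 ∘ trans (sym (ℚ.+-identityʳ a))) (+P-vanishes zp zq)
+P-hasDegreeˡ {a ∷ p} {b ∷ q} (shift d)        b<n         = shift (+P-hasDegreeˡ d b<n)

+P-hasDegreeʳ : ∀ {p q n} → DegreeBelow p n → HasDegree q n → HasDegree (p +P q) n
+P-hasDegreeʳ {p} {q} {n} b<n d =
  subst (λ r → HasDegree r n) (+P-comm q p) (+P-hasDegreeˡ d b<n)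

map-vanishes : ∀ {f : ℚ → ℚ} {p} → f 0ℚ ≡ 0ℚ → Vanishes p → Vanishes (map f p)
map-vanishes f0≡0 []         = []
map-vanishes f0≡0 (refl ∷ z) = f0≡0 ∷ map-vanishes f0≡0 z

map-degreeBelow : ∀ {f : ℚ → ℚ} {p} n → f 0ℚ ≡ 0ℚ → DegreeBelow p n → DegreeBelow (map f p) n
map-degreeBelow {p = p} n f0≡0 b =
  subst Vanishes (sym (drop-map n p)) (map-vanishes f0≡0 b)

map-hasDegree : ∀ {f : ℚ → ℚ} {p n} → f 0ℚ ≡ 0ℚ → (∀ {x} → x ≢ 0ℚ → f x ≢ 0ℚ) →
                HasDegree p n → HasDegree (map f p) n
map-hasDegree f0≡0 f≢0 (leading a≢0 z) = leading (f≢0 a≢0) (map-vanishes f0≡0 z)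
map-hasDegree f0≡0 f≢0 (shift d)       = shift (map-hasDegree f0≡0 f≢0 d)

x≢0∧y≢0⇒x*y≢0 : ∀ {x y} → x ≢ 0ℚ → y ≢ 0ℚ → x ℚ.* y ≢ 0ℚ
x≢0∧y≢0⇒x*y≢0 {x} {y} x≢0 y≢0 x*y≡0 = y≢0 (begin
  y                    ≡⟨ sym (ℚ.*-identityˡ y) ⟩
  1ℚ ℚ.* y             ≡⟨ cong (ℚ._* y) (sym (ℚ.*-inverseˡ x)) ⟩
  ℚ.1/ x ℚ.* x ℚ.* y   ≡⟨ ℚ.*-assoc (ℚ.1/ x) x y ⟩
  ℚ.1/ x ℚ.* (x ℚ.* y) ≡⟨ cong (ℚ.1/ x ℚ.*_) x*y≡0 ⟩
  ℚ.1/ x ℚ.* 0ℚ        ≡⟨ ℚ.*-zeroʳ (ℚ.1/ x) ⟩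
  0ℚ                   ∎)
  where
  open ≡-Reasoning
  instance _ = ℚ.≢-nonZero x≢0

neg-≢0 : ∀ {x} → x ≢ 0ℚ → ℚ.- x ≢ 0ℚ
neg-≢0 {x} x≢0 = x≢0 ∘ ℚ.neg-injective {x} {0ℚ}

*P-vanishesˡ : ∀ {p} q → Vanishes p → Vanishes (p *P q)
*P-vanishesˡ q []         = []
*P-vanishesˡ q (refl ∷ z) =
  +P-vanishes (map⁺ (universal ℚ.*-zeroˡ q)) (refl ∷ *P-vanishesˡ q z)

*P-hasDegree : ∀ {p q m n} → HasDegree p m → HasDegree q n → HasDegree (p *P q) (m ℕ.+ n)
*P-hasDegree {a ∷ p} {q} {n = n} (leading a≢0 zp) dq =
  +P-hasDegreeˡ (map-hasDegree (ℚ.*-zeroʳ a) (x≢0∧y≢0⇒x*y≢0 a≢0) dq) tail<n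
  where
  tail<n : DegreeBelow (0ℚ ∷ (p *P q)) n
  tail<n = drop⁺ n (refl ∷ *P-vanishesˡ q zp)
*P-hasDegree {a ∷ p} {q} {suc m} {n} (shift dp) dq =
  +P-hasDegreeʳ (map-degreeBelow {a ℚ.*_} {q} (suc (m ℕ.+ n)) (ℚ.*-zeroʳ a)
                   (degreeBelow-mono {q} (s≤s (ℕ.m≤n+m n m)) (hasDegree⇒degreeBelow dq)))
                (shift (*P-hasDegree dp dq))

record HasDegreeF (x : RF) (d : ℤ) : Set where
  constructor hasDegreeF
  field
    {numDegree denDegree} : ℕ
    num-hasDegree : HasDegree (num x) numDegree
    den-hasDegree : HasDegree (den x) denDegree
    degree-≡      : + numDegree - + denDegree ≡ d

hasDegreeF⇒nonZeroF : ∀ {x d} → HasDegreeF x d → NonZeroF x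
hasDegreeF⇒nonZeroF (hasDegreeF dn dd _) = hasDegree⇒nonZeroP dn , hasDegree⇒nonZeroP dd

hasDegreeF⇒degF : ∀ {x d} → HasDegreeF x d → degF x ≡ d
hasDegreeF⇒degF (hasDegreeF dn dd eq) =
  trans (cong₂ (λ m n → + m - + n) (hasDegree⇒degP dn) (hasDegree⇒degP dd)) eq

-F-hasDegreeF : ∀ {x d} → HasDegreeF x d → HasDegreeF (-F x) d
-F-hasDegreeF (hasDegreeF dn dd eq) = hasDegreeF (map-hasDegree refl neg-≢0 dn) dd eq

/F-hasDegreeF : ∀ {x y d e} → HasDegreeF x d → HasDegreeF y e → HasDegreeF (x /F y) (d - e)
/F-hasDegreeF (hasDegreeF {a} {b} da db refl) (hasDegreeF {c} {e} dc de refl) =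
  hasDegreeF (*P-hasDegree da de) (*P-hasDegree db dc) (regroup (+ a) (+ b) (+ c) (+ e))
  where
  regroup : ∀ a b c e → (a ℤ.+ e) - (b ℤ.+ c) ≡ (a - b) - (c - e)
  regroup = solve-∀

-<-⇒+<+ : ∀ a b c d → + a - + b ℤ.< + c - + d → a ℕ.+ d ℕ.< c ℕ.+ b
-<-⇒+<+ a b c d lt =
  ℤ.drop‿+<+ (subst₂ ℤ._<_ (cancelˡ (+ a) (+ b) (+ d)) (cancelʳ (+ c) (+ d) (+ b))
                          (ℤ.+-monoˡ-< (+ b ℤ.+ + d) lt))
  where
  cancelˡ : ∀ x y z → (x - y) ℤ.+ (y ℤ.+ z) ≡ x ℤ.+ z
  cancelˡ = solve-∀
  cancelʳ : ∀ x y z → (x - y) ℤ.+ (z ℤ.+ y) ≡ x ℤ.+ z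
  cancelʳ = solve-∀

+F-hasDegreeFˡ : ∀ {x y d e} → HasDegreeF x d → HasDegreeF y e → e ℤ.< d → HasDegreeF (x +F y) d
+F-hasDegreeFˡ {x} {y} (hasDegreeF {a} {b} da db refl) (hasDegreeF {c} {e} dc de refl) e<d =
  hasDegreeF (+P-hasDegreeˡ (*P-hasDegree da de) smaller) (*P-hasDegree db de)
             (cancel (+ a) (+ b) (+ e))
  where
  smaller : DegreeBelow (num y *P den x) (a ℕ.+ e)
  smaller = degreeBelow-mono {num y *P den x} (-<-⇒+<+ c e a b e<d)
                             (hasDegree⇒degreeBelow (*P-hasDegree dc db))
  cancel : ∀ a b e → (a ℤ.+ e) - (b ℤ.+ e) ≡ a - b
  cancel = solve-∀

+F-hasDegreeFʳ : ∀ {x y d e} → HasDegreeF x d → HasDegreeF y e → d ℤ.< e → HasDegreeF (x +F y) e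
+F-hasDegreeFʳ {x} {y} (hasDegreeF {a} {b} da db refl) (hasDegreeF {c} {e} dc de refl) d<e =
  hasDegreeF (+P-hasDegreeʳ smaller (*P-hasDegree dc db)) (*P-hasDegree db de)
             (cancel (+ c) (+ b) (+ e))
  where
  smaller : DegreeBelow (num x *P den y) (c ℕ.+ b)
  smaller = degreeBelow-mono {num x *P den y} (-<-⇒+<+ a b c e d<e)
                             (hasDegree⇒degreeBelow (*P-hasDegree da de))
  cancel : ∀ c b e → (c ℤ.+ b) - (b ℤ.+ e) ≡ c - e
  cancel = solve-∀

uF-hasDegreeF : HasDegreeF uF (+ 1)
uF-hasDegreeF = hasDegreeF (shift (leading ℚ.1≢0 [])) (leading ℚ.1≢0 []) refl

u²F-hasDegreeF : HasDegreeF u²F (+ 2)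
u²F-hasDegreeF = hasDegreeF (shift (shift (leading ℚ.1≢0 []))) (leading ℚ.1≢0 []) refl

record ν₂[_]≡_ (n v : ℕ) : Set where
  constructor ν₂≡
  field
    2^v∣n   : 2 ^ v ∣ n
    2^1+v∤n : ¬ (2 ^ suc v ∣ n)

2∤odd : ∀ k → ¬ (2 ∣ suc (2 ℕ.* k))
2∤odd k (divides q eq) = ℕ.even≢odd q k (trans (ℕ.*-comm 2 q) (sym eq))

ν₂[odd]≡0 : ∀ k → ν₂[ suc (2 ℕ.* k) ]≡ 0
ν₂[odd]≡0 k = ν₂≡ (1∣ _) (2∤odd k)

ν₂[odd]-unique : ∀ {k v} → ν₂[ suc (2 ℕ.* k) ]≡ v → v ≡ 0
ν₂[odd]-unique {v = zero}      _            = refl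
ν₂[odd]-unique {k} {v = suc v} (ν₂≡ 2^v∣ _) = ⊥-elim (2∤odd k (∣-trans (m∣m*n (2 ^ v)) 2^v∣))

ν₂-double : ∀ {n v} → ν₂[ n ]≡ v → ν₂[ 2 ℕ.* n ]≡ suc v
ν₂-double (ν₂≡ 2^v∣ 2^1+v∤) = ν₂≡ (*-monoʳ-∣ 2 2^v∣) (2^1+v∤ ∘ *-cancelˡ-∣ 2)

ν₂-half : ∀ {n v} → ν₂[ 2 ℕ.* n ]≡ v → ∃[ w ] v ≡ suc w × ν₂[ n ]≡ w
ν₂-half {n} {zero}  (ν₂≡ _ 2∤) = ⊥-elim (2∤ (m∣m*n n))
ν₂-half {v = suc w} (ν₂≡ 2^v∣ 2^1+v∤) =
  w , refl , ν₂≡ (*-cancelˡ-∣ 2 2^v∣) (2^1+v∤ ∘ *-monoʳ-∣ 2)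

data Split : ℕ → ℕ × Bool → Set where
  even : ∀ k → Split (k ℕ.+ k) (k , false)
  odd  : ∀ k → Split (suc (k ℕ.+ k)) (k , true)

split-view : ∀ n → Split n (split n)
split-view zero          = even 0
split-view (suc zero)    = odd 0
split-view (suc (suc n)) with split n | split-view n
... | _ | even k = subst (λ m → Split m (suc k , false)) (cong suc (ℕ.+-suc k k)) (even (suc k))
... | _ | odd k  = subst (λ m → Split m (suc k , true)) (cong (suc ∘ suc) (ℕ.+-suc k k)) (odd (suc k))

k+k≡2*k : ∀ k → k ℕ.+ k ≡ 2 ℕ.* k
k+k≡2*k = ℕ-Solver.solve-∀

2+k+k≡2*[1+k] : ∀ k → 2 ℕ.+ (k ℕ.+ k) ≡ 2 ℕ.* suc k
2+k+k≡2*[1+k] = ℕ-Solver.solve-∀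

ν₂[1+k+k]≡0 : ∀ k → ν₂[ suc (k ℕ.+ k) ]≡ 0
ν₂[1+k+k]≡0 k = subst (λ m → ν₂[ suc m ]≡ 0) (sym (k+k≡2*k k)) (ν₂[odd]≡0 k)

ν₂-exists : ∀ n → ∃[ v ] ν₂[ suc n ]≡ v
ν₂-exists = <-rec (λ n → ∃[ v ] ν₂[ suc n ]≡ v) step
  where
  step : ∀ n → (∀ {m} → m ℕ.< n → ∃[ v ] ν₂[ suc m ]≡ v) → ∃[ v ] ν₂[ suc n ]≡ v
  step n rec with split n | split-view n
  ... | _ | even k = 0 , ν₂[1+k+k]≡0 k
  ... | _ | odd k with rec {k} (s≤s (ℕ.m≤m+n k k))
  ...   | v , ν = suc v , subst (ν₂[_]≡ suc v) (sym (2+k+k≡2*[1+k] k)) (ν₂-double ν)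

expectedDegree : ℕ → ℤ
expectedDegree v = + 2 * (+ 1 - + v)

expectedDegree-suc : ∀ w → expectedDegree w - expectedDegree 0 ≡ expectedDegree (suc w)
expectedDegree-suc w = identity (+ w)
  where
  identity : ∀ w → + 2 * (+ 1 - w) - + 2 ≡ + 2 * (+ 1 - (+ 1 ℤ.+ w))
  identity = solve-∀

expectedDegree-suc<2 : ∀ w → expectedDegree (suc w) ℤ.< + 2
expectedDegree-suc<2 zero    = +<+ (s≤s z≤n)
expectedDegree-suc<2 (suc w) = -<+

α-hasDegreeF : ∀ i → HasDegreeF (α i) (+ 1)
α-hasDegreeF i with proj₂ (split i)
... | true  = -F-hasDegreeF uF-hasDegreeF
... | false = uF-hasDegreeF

oddRecurrence-hasDegreeF : ∀ {x y w} → HasDegreeF x (expectedDegree w) → HasDegreeF y (+ 2) →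
                           HasDegreeF (-F (x /F y)) (expectedDegree (suc w))
oddRecurrence-hasDegreeF {w = w} hx hy =
  subst (HasDegreeF _) (expectedDegree-suc w) (-F-hasDegreeF (/F-hasDegreeF hx hy))

evenRecurrence-hasDegreeF : ∀ i {y d} → HasDegreeF y d → d ℤ.< + 2 →
                            HasDegreeF ((α i +F u²F) -F y) (+ 2)
evenRecurrence-hasDegreeF i hy d<2 =
  +F-hasDegreeFˡ (+F-hasDegreeFʳ (α-hasDegreeF i) u²F-hasDegreeF (+<+ ℕ.≤-refl))
                 (-F-hasDegreeF hy) d<2

-- βF f m is β_m for every fuel f > m, so the induction runs on the fuel.
βF-hasDegreeF : ∀ f m {v} → 2 ≤ m → m ℕ.< f → ν₂[ m ∸ 1 ]≡ v →
                HasDegreeF (βF f m) (expectedDegree v)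
βF-hasDegreeF zero    m                   _               ()          _
βF-hasDegreeF (suc f) 0                   ()              _           _
βF-hasDegreeF (suc f) 1                   (s≤s ())        _           _
βF-hasDegreeF (suc f) 2                   _               _           ν
  rewrite ν₂[odd]-unique {0} ν =
  +F-hasDegreeFˡ u²F-hasDegreeF (-F-hasDegreeF uF-hasDegreeF) (+<+ ℕ.≤-refl)
βF-hasDegreeF (suc f) (suc (suc (suc n))) {v} _ (s≤s 2+n<f) ν with split n | split-view n
... | _ | even k  -- m = 2k + 3
  with ν₂-half {suc k} (subst (ν₂[_]≡ v) (2+k+k≡2*[1+k] k) ν)
... | w , refl , ν[1+k] =
  oddRecurrence-hasDegreeF {w = w}
    (βF-hasDegreeF f (2 ℕ.+ k) (s≤s (s≤s z≤n))
       (ℕ.≤-<-trans (s≤s (s≤s (ℕ.m≤m+n k k))) 2+n<f) ν[1+k])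
    (βF-hasDegreeF f (2 ℕ.+ (k ℕ.+ k)) (s≤s (s≤s z≤n)) 2+n<f (ν₂[1+k+k]≡0 k))
βF-hasDegreeF (suc f) (suc (suc (suc n))) {v} _ (s≤s 2+n<f) ν
    | _ | odd k  -- m = 2k + 4
  with ν₂-exists k
... | w , ν[1+k]
  rewrite ν₂[odd]-unique {suc k} (subst (ν₂[_]≡ v) (cong suc (2+k+k≡2*[1+k] k)) ν) =
  evenRecurrence-hasDegreeF (2 ℕ.+ k)
    (βF-hasDegreeF f (3 ℕ.+ (k ℕ.+ k)) (s≤s (s≤s z≤n)) 2+n<f
      (subst (ν₂[_]≡ suc w) (sym (2+k+k≡2*[1+k] k)) (ν₂-double ν[1+k])))
    (expectedDegree-suc<2 w)

proposition3 : (m v : ℕ) → 2 ≤ m → 2 ^ v ∣ m ∸ 1 → ¬ (2 ^ suc v ∣ m ∸ 1) →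
    NonZeroF (β m) × degF (β m) ≡ + 2 * (+ 1 - + v)
proposition3 m v 2≤m 2^v∣ 2^1+v∤ = hasDegreeF⇒nonZeroF deg , hasDegreeF⇒degF deg
  where
  deg : HasDegreeF (β m) (expectedDegree v)
  deg = βF-hasDegreeF (suc m) m {v} 2≤m ℕ.≤-refl (ν₂≡ 2^v∣ 2^1+v∤)
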